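{- Let $\mathcal{J}(x,y)=\alpha x^2+\beta xy+\gamma y^2$ be an integral binary quadratic form with $\gcd(\alpha,\beta,\gamma)=1$ and $\beta^2-4\alpha\gamma\neq0$, and let $n_\beta=2$ if $\beta$ is odd and $n_\beta=1$ if $\beta$ is even. For any non-proportional $f,g\in W_{\mathcal{J}}(\mathbb{Z})$, the following are equivalent: (i) the pair $(f,g)$ is primitive; (ii) $(f,g)$ is a $\mathbb{Z}$-basis of $W_{\mathcal{J}}(\mathbb{Z})$; (iii) $\mathcal{J}_{(f,g),2}=\pm n_\beta\alpha$ and $\mathcal{J}_{(f,g),1}=\pm n_\beta\beta$; (iv) $\mathcal{J}_{(f,g)}(x,y)=\pm n_\beta\mathcal{J}(x,y)$.
   Context: For $T=\begin{pmatrix}t_1&t_2\\t_3&t_4\end{pmatrix}$, the twisted action on binary quadratic forms is $\varphi_T(x,y)=\det(T)^{ -1}\varphi(t_1x+t_2y,t_3x+t_4y)$. $M_{\mathcal{J}}=\begin{pmatrix}\beta&2\gamma\\-2\alpha&-\beta\end{pmatrix}$, and $W_{\mathcal{J}}(\mathbb{Z})$ is the set of integral binary quadratic forms $\varphi$ with $\varphi_{M_{\mathcal{J}}}=-\varphi$. For binary quadratic forms $f=f_2x^2+f_1xy+f_0y^2$, $g=g_2x^2+g_1xy+g_0y^2$, $\mathcal{J}_{(f,g)}(x,y)=\mathcal{J}_{(f,g),2}x^2+\mathcal{J}_{(f,g),1}xy+\mathcal{J}_{(f,g),0}y^2$ with $\mathcal{J}_{(f,g),2}=f_2g_1-f_1g_2$,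 $\mathcal{J}_{(f,g),1}=2(f_2g_0-f_0g_2)$, $\mathcal{J}_{(f,g),0}=f_1g_0-f_0g_1$. An integral pair $(f,g)$ is primitive if $\Delta(\mathcal{J}_{(f,g)})\neq0$ and $\gcd(\mathcal{J}_{(f,g),2},\mathcal{J}_{(f,g),1}/2,\mathcal{J}_{(f,g),0})=1$, where $\Delta(\varphi_2x^2+\varphi_1xy+\varphi_0y^2)=\varphi_1^2-4\varphi_2\varphi_0$. -}

module Defs where

open import Data.Integer using (ℤ; +_; _+_; _*_; -_; _-_; ∣_∣)
open import Data.Integer.GCD using (gcd)
open import Data.Nat using (ℕ)
open import Data.Nat.Divisibility using (_∣?_)
open import Data.Bool using (if_then_else_)
open import Data.Product using (_×_; Σ; ∃; ∃-syntax; _,_)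
open import Data.Sum using (_⊎_)
open import Relation.Nullary using (¬_; does)
open import Relation.Binary.PropositionalEquality using (_≡_)

-- An integral binary quadratic form  a x² + b xy + c y²,  stored by its
-- coefficients (a , b , c) = (φ₂ , φ₁ , φ₀).
record BQF : Set where
  constructor bqf
  field
    c₂ c₁ c₀ : ℤ
open BQF public

record Mat2 : Set where
  constructor mat
  field
    t₁ t₂ t₃ t₄ : ℤ
open Mat2 public

det : Mat2 → ℤ
det T = t₁ T * t₄ T - t₂ T * t₃ T

disc : BQF → ℤ
disc φ = c₁ φ * c₁ φ - + 4 * c₂ φ * c₀ φ

-- The coefficients of the (untwisted) substitution  φ(t₁x+t₂y, t₃x+t₄y).
subst : BQF → Mat2 → BQF
subst φ T = bqf
  (c₂ φ * t₁ T * t₁ T + c₁ φ * t₁ T * t₃ T + c₀ φ * t₃ T * t₃ T)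
  (+ 2 * c₂ φ * t₁ T * t₂ T + c₁ φ * (t₁ T * t₄ T + t₂ T * t₃ T)
     + + 2 * c₀ φ * t₃ T * t₄ T)
  (c₂ φ * t₂ T * t₂ T + c₁ φ * t₂ T * t₄ T + c₀ φ * t₄ T * t₄ T)

_·_ : ℤ → BQF → BQF
k · φ = bqf (k * c₂ φ) (k * c₁ φ) (k * c₀ φ)

_⊕_ : BQF → BQF → BQF
φ ⊕ ψ = bqf (c₂ φ + c₂ ψ) (c₁ φ + c₁ ψ) (c₀ φ + c₀ ψ)

-- The twisted action  φ_T = det(T)⁻¹ φ(t₁x+t₂y, t₃x+t₄y).  For det T ≠ 0,
-- the equation  φ_T = λ φ  (λ ∈ ℤ) is equivalent to the integral identity
--   φ(t₁x+t₂y, t₃x+t₄y) = (λ · det T) φ,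
-- which is how we express it (avoiding rational coefficients).
TwistedEq : BQF → Mat2 → ℤ → Set
TwistedEq φ T λ' = subst φ T ≡ (λ' * det T) · φ

M : BQF → Mat2
M J = mat (c₁ J) (+ 2 * c₀ J) (- (+ 2 * c₂ J)) (- c₁ J)

InW : BQF → BQF → Set
InW J φ = TwistedEq φ (M J) (- + 1)

Jfg : BQF → BQF → BQF
Jfg f g = bqf (c₂ f * c₁ g - c₁ f * c₂ g)
              (+ 2 * (c₂ f * c₀ g - c₀ f * c₂ g))
              (c₁ f * c₀ g - c₀ f * c₁ g)

Jfg₁/2 : BQF → BQF → ℤ
Jfg₁/2 f g = c₂ f * c₀ g - c₀ f * c₂ g

zeroForm : BQF
zeroForm = bqf (+ 0) (+ 0) (+ 0)

-- f and g are proportional iff some nontrivial ℤ-combination vanishes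
-- (equivalently: linearly dependent over ℚ).
Proportional : BQF → BQF → Set
Proportional f g = ∃[ a ] ∃[ b ] (¬ (a ≡ + 0 × b ≡ + 0) × ((a · f) ⊕ (b · g)) ≡ zeroForm)

Primitive : BQF → BQF → Set
Primitive f g = ¬ (disc (Jfg f g) ≡ + 0)
              × gcd (gcd (c₂ (Jfg f g)) (Jfg₁/2 f g)) (c₀ (Jfg f g)) ≡ + 1

IsZBasisW : BQF → BQF → BQF → Set
IsZBasisW J f g =
  InW J f × InW J g
  × (∀ φ → InW J φ → ∃[ a ] ∃[ b ] φ ≡ (a · f) ⊕ (b · g))
  × (∀ a b → ((a · f) ⊕ (b · g)) ≡ zeroForm → a ≡ + 0 × b ≡ + 0)

nβ : ℤ → ℤ
nβ β = if does (2 ∣? ∣ β ∣) then + 1 else + 2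

_≡±_ : ℤ → ℤ → Set
x ≡± y = x ≡ y ⊎ x ≡ - y

{-# OPTIONS --safe #-}

-- Read forms as vectors of ℤ³ through their coefficients. Then W_J(ℤ) is the lattice of
-- integer vectors orthogonal to n = (n_β γ, -n_β β/2, n_β α), which is primitive because
-- gcd(α, β, γ) = 1: there is u with u ∙ n = 1. For f, g in W_J(ℤ) the cross product f ⨯ g
-- is parallel to n, hence equal to t n with t = u ∙ (f ⨯ g), and J_(f,g) is f ⨯ g read
-- back as a form, so J_(f,g) = t n_β J. Each of (i)-(iv) says t = ±1: (i) because the
-- common divisors of the coordinates of t n are those of t; (ii) because |t| is the index
-- of ℤf + ℤg in W_J(ℤ); (iii) and (iv) by comparing coefficients, using J ≠ 0.
module Submission where

open import Defs
open import Data.Integer using (ℤ; +_; -_; _*_)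
open import Data.Integer.GCD using (gcd)
open import Data.Product using (_×_; ∃-syntax)
open import Data.Sum using (_⊎_)
open import Relation.Nullary using (¬_)
open import Relation.Binary.PropositionalEquality using (_≡_)
open import Function.Bundles using (_⇔_)

open import Algebra.Bundles using (AbelianGroup)
import Algebra.Properties.Group as GroupProperties
open import Data.Empty using (⊥-elim)
open import Data.Integer using (_+_; _-_; 0ℤ; 1ℤ; -1ℤ; -[1+_]; ∣_∣)
open import Data.Integer.Divisibility.Signed
  using (_∣_; divides; ∣ᵤ⇒∣; ∣⇒∣ᵤ; ∣-refl; ∣-trans; ∣m∣n⇒∣m+n; ∣n⇒∣m*n; ∣m⇒∣-m)
import Data.Integer.Base as ℤ
import Data.Integer.DivMod as ℤ
import Data.Integer.GCD as ℤ
import Data.Integer.Properties as ℤ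
open import Data.Integer.Tactic.RingSolver using (solve-∀)
import Data.Nat as ℕ
open import Data.Nat.Divisibility using (_∣?_; ∣1⇒≡1) renaming (_∣_ to _∣ℕ_)
open import Data.Nat.GCD using (gcd-GCD; module Bézout)
open import Data.Product using (_,_; proj₁; proj₂)
open import Data.Sum using (inj₁; inj₂)
import Data.Sum as Sum
open import Data.Bool using (true; false; if_then_else_)
open import Function using (_∘_)
open import Function.Bundles using (mk⇔; Equivalence)
open import Function.Properties.Equivalence using () renaming (trans to ⇔-trans; sym to ⇔-sym)
import Relation.Binary.PropositionalEquality as ≡
open import Relation.Binary.PropositionalEquality
  using (_≢_; refl; sym; trans; cong; cong₂; module ≡-Reasoning)
open import Relation.Nullary using (Dec; yes; no; does)
open import Relation.Nullary.Decidable using (dec-true; dec-false)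

open GroupProperties (AbelianGroup.group ℤ.+-0-abelianGroup)
  using () renaming (identityʳ-unique to +-identityʳ-unique)

infix  4 _∣ᵛ_
infix  8 _∙_
infixl 9 _⨯_

_∙_ : BQF → BQF → ℤ
x ∙ y = c₂ x * c₂ y + c₁ x * c₁ y + c₀ x * c₀ y

_⨯_ : BQF → BQF → BQF
x ⨯ y = bqf (c₁ x * c₀ y - c₀ x * c₁ y)
            (c₀ x * c₂ y - c₂ x * c₀ y)
            (c₂ x * c₁ y - c₁ x * c₂ y)

e₂ e₁ e₀ : BQF
e₂ = bqf 1ℤ 0ℤ 0ℤ
e₁ = bqf 0ℤ 1ℤ 0ℤ
e₀ = bqf 0ℤ 0ℤ 1ℤ

_∣ᵛ_ : ℤ → BQF → Set
d ∣ᵛ v = (d ∣ c₂ v) × (d ∣ c₁ v) × (d ∣ c₀ v)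

InSpan : BQF → BQF → BQF → Set
InSpan a b c = ∃[ p ] ∃[ q ] c ≡ (p · a) ⊕ (q · b)

-- Vector identities are proved coordinatewise by the ring solver, each coordinate stated
-- with the definitions of _∙_, _⨯_, _·_ and _⊕_ unfolded by hand, as solve-∀ needs.
≡-by-coords : ∀ {x y : BQF} → c₂ x ≡ c₂ y → c₁ x ≡ c₁ y → c₀ x ≡ c₀ y → x ≡ y
≡-by-coords refl refl refl = refl

·-identityˡ : ∀ x → 1ℤ · x ≡ x
·-identityˡ x = ≡-by-coords (ℤ.*-identityˡ _) (ℤ.*-identityˡ _) (ℤ.*-identityˡ _)

·-assoc : ∀ k l x → (k * l) · x ≡ k · (l · x)
·-assoc k l x = ≡-by-coords (ℤ.*-assoc k l _) (ℤ.*-assoc k l _) (ℤ.*-assoc k l _)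

·-distrib-span : ∀ k p q a b → k · ((p · a) ⊕ (q · b)) ≡ ((k * p) · a) ⊕ ((k * q) · b)
·-distrib-span k p q a b = ≡-by-coords
  (distrib k p q (c₂ a) (c₂ b)) (distrib k p q (c₁ a) (c₁ b)) (distrib k p q (c₀ a) (c₀ b))
  where
  distrib : ∀ k p q a b → k * (p * a + q * b) ≡ k * p * a + k * q * b
  distrib = solve-∀

⊕-0· : ∀ x y → x ⊕ (0ℤ · y) ≡ x
⊕-0· x y = ≡-by-coords (identity (c₂ x) (c₂ y)) (identity (c₁ x) (c₁ y)) (identity (c₀ x) (c₀ y))
  where
  identity : ∀ a b → a + 0ℤ * b ≡ a
  identity = solve-∀

⊕-cancel : ∀ {x y} → x ≡ x ⊕ y → y ≡ zeroForm
⊕-cancel eq = ≡-by-coords (cancel (cong c₂ eq)) (cancel (cong c₁ eq)) (cancel (cong c₀ eq))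
  where
  cancel : ∀ {i j} → i ≡ i + j → j ≡ 0ℤ
  cancel {i} {j} i≡i+j = +-identityʳ-unique i j (sym i≡i+j)

∣ᵛ-· : ∀ k v → k ∣ᵛ (k · v)
∣ᵛ-· k v = divides (c₂ v) (ℤ.*-comm k (c₂ v))
         , divides (c₁ v) (ℤ.*-comm k (c₁ v))
         , divides (c₀ v) (ℤ.*-comm k (c₀ v))

∣ᵛ⇒∣∙ : ∀ {d v} u → d ∣ᵛ v → d ∣ u ∙ v
∣ᵛ⇒∣∙ u (d∣v₂ , d∣v₁ , d∣v₀) =
  ∣m∣n⇒∣m+n (∣m∣n⇒∣m+n (∣n⇒∣m*n (c₂ u) d∣v₂) (∣n⇒∣m*n (c₁ u) d∣v₁)) (∣n⇒∣m*n (c₀ u) d∣v₀)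

∙-·ˡ : ∀ k x y → (k · x) ∙ y ≡ k * (x ∙ y)
∙-·ˡ k (bqf x₂ x₁ x₀) (bqf y₂ y₁ y₀) = identity k x₂ x₁ x₀ y₂ y₁ y₀
  where
  identity : ∀ k x₂ x₁ x₀ y₂ y₁ y₀ →
    k * x₂ * y₂ + k * x₁ * y₁ + k * x₀ * y₀ ≡ k * (x₂ * y₂ + x₁ * y₁ + x₀ * y₀)
  identity = solve-∀

∙-·ʳ : ∀ k x y → x ∙ (k · y) ≡ k * (x ∙ y)
∙-·ʳ k (bqf x₂ x₁ x₀) (bqf y₂ y₁ y₀) = identity k x₂ x₁ x₀ y₂ y₁ y₀
  where
  identity : ∀ k x₂ x₁ x₀ y₂ y₁ y₀ →
    x₂ * (k * y₂) + x₁ * (k * y₁) + x₀ * (k * y₀) ≡ k * (x₂ * y₂ + x₁ * y₁ + x₀ * y₀)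
  identity = solve-∀

∙-basis : ∀ x → x ∙ e₂ ≡ c₂ x × x ∙ e₁ ≡ c₁ x × x ∙ e₀ ≡ c₀ x
∙-basis (bqf x₂ x₁ x₀) = pick₂ x₂ x₁ x₀ , pick₁ x₂ x₁ x₀ , pick₀ x₂ x₁ x₀
  where
  pick₂ : ∀ a b c → a * 1ℤ + b * 0ℤ + c * 0ℤ ≡ a
  pick₂ = solve-∀
  pick₁ : ∀ a b c → a * 0ℤ + b * 1ℤ + c * 0ℤ ≡ b
  pick₁ = solve-∀
  pick₀ : ∀ a b c → a * 0ℤ + b * 0ℤ + c * 1ℤ ≡ c
  pick₀ = solve-∀

∙-⨯-self : ∀ n x → n ∙ (n ⨯ x) ≡ 0ℤ
∙-⨯-self (bqf n₂ n₁ n₀) (bqf x₂ x₁ x₀) = identity n₂ n₁ n₀ x₂ x₁ x₀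
  where
  identity : ∀ n₂ n₁ n₀ x₂ x₁ x₀ →
    n₂ * (n₁ * x₀ - n₀ * x₁) + n₁ * (n₀ * x₂ - n₂ * x₀) + n₀ * (n₂ * x₁ - n₁ * x₂) ≡ 0ℤ
  identity = solve-∀

⨯-bilinear : ∀ a b p q r s →
  ((p · a) ⊕ (q · b)) ⨯ ((r · a) ⊕ (s · b)) ≡ (p * s - r * q) · (a ⨯ b)
⨯-bilinear (bqf a₂ a₁ a₀) (bqf b₂ b₁ b₀) p q r s = ≡-by-coords
  (det-bilinear p q r s a₁ a₀ b₁ b₀)
  (det-bilinear p q r s a₀ a₂ b₀ b₂)
  (det-bilinear p q r s a₂ a₁ b₂ b₁)
  where
  det-bilinear : ∀ p q r s a a′ b b′ →
    (p * a + q * b) * (r * a′ + s * b′) - (p * a′ + q * b′) * (r * a + s * b)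
    ≡ (p * s - r * q) * (a * b′ - a′ * b)
  det-bilinear = solve-∀

⨯-⨯-common : ∀ n x y → (n ⨯ x) ⨯ (n ⨯ y) ≡ (n ∙ (x ⨯ y)) · n
⨯-⨯-common (bqf n₂ n₁ n₀) (bqf x₂ x₁ x₀) (bqf y₂ y₁ y₀) = ≡-by-coords
  (coord₂ n₂ n₁ n₀ x₂ x₁ x₀ y₂ y₁ y₀)
  (coord₁ n₂ n₁ n₀ x₂ x₁ x₀ y₂ y₁ y₀)
  (coord₀ n₂ n₁ n₀ x₂ x₁ x₀ y₂ y₁ y₀)
  where
  coord₂ : ∀ n₂ n₁ n₀ x₂ x₁ x₀ y₂ y₁ y₀ →
    (n₀ * x₂ - n₂ * x₀) * (n₂ * y₁ - n₁ * y₂) - (n₂ * x₁ - n₁ * x₂) * (n₀ * y₂ - n₂ * y₀)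
    ≡ (n₂ * (x₁ * y₀ - x₀ * y₁) + n₁ * (x₀ * y₂ - x₂ * y₀) + n₀ * (x₂ * y₁ - x₁ * y₂)) * n₂
  coord₂ = solve-∀
  coord₁ : ∀ n₂ n₁ n₀ x₂ x₁ x₀ y₂ y₁ y₀ →
    (n₂ * x₁ - n₁ * x₂) * (n₁ * y₀ - n₀ * y₁) - (n₁ * x₀ - n₀ * x₁) * (n₂ * y₁ - n₁ * y₂)
    ≡ (n₂ * (x₁ * y₀ - x₀ * y₁) + n₁ * (x₀ * y₂ - x₂ * y₀) + n₀ * (x₂ * y₁ - x₁ * y₂)) * n₁
  coord₁ = solve-∀
  coord₀ : ∀ n₂ n₁ n₀ x₂ x₁ x₀ y₂ y₁ y₀ →
    (n₁ * x₀ - n₀ * x₁) * (n₀ * y₂ - n₂ * y₀) - (n₀ * x₂ - n₂ * x₀) * (n₁ * y₀ - n₀ * y₁)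
    ≡ (n₂ * (x₁ * y₀ - x₀ * y₁) + n₁ * (x₀ * y₂ - x₂ * y₀) + n₀ * (x₂ * y₁ - x₁ * y₂)) * n₀
  coord₀ = solve-∀

-- u ⨯ ((a ⨯ b) ⨯ n), expanded twice by the rule x ⨯ (y ⨯ z) = (x ∙ z) y - (x ∙ y) z.
⨯-decomposition : ∀ u n a b →
  (u ∙ n) · (a ⨯ b) ≡ (((u ∙ (a ⨯ b)) · n) ⊕ ((n ∙ a) · (u ⨯ b))) ⊕ ((- (n ∙ b)) · (u ⨯ a))
⨯-decomposition (bqf u₂ u₁ u₀) (bqf n₂ n₁ n₀) (bqf a₂ a₁ a₀) (bqf b₂ b₁ b₀) = ≡-by-coords
  (coord₂ u₂ u₁ u₀ n₂ n₁ n₀ a₂ a₁ a₀ b₂ b₁ b₀)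
  (coord₁ u₂ u₁ u₀ n₂ n₁ n₀ a₂ a₁ a₀ b₂ b₁ b₀)
  (coord₀ u₂ u₁ u₀ n₂ n₁ n₀ a₂ a₁ a₀ b₂ b₁ b₀)
  where
  coord₂ : ∀ u₂ u₁ u₀ n₂ n₁ n₀ a₂ a₁ a₀ b₂ b₁ b₀ →
    (u₂ * n₂ + u₁ * n₁ + u₀ * n₀) * (a₁ * b₀ - a₀ * b₁)
    ≡ (u₂ * (a₁ * b₀ - a₀ * b₁) + u₁ * (a₀ * b₂ - a₂ * b₀) + u₀ * (a₂ * b₁ - a₁ * b₂)) * n₂
    + (n₂ * a₂ + n₁ * a₁ + n₀ * a₀) * (u₁ * b₀ - u₀ * b₁)
    + (- (n₂ * b₂ + n₁ * b₁ + n₀ * b₀)) * (u₁ * a₀ - u₀ * a₁)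
  coord₂ = solve-∀
  coord₁ : ∀ u₂ u₁ u₀ n₂ n₁ n₀ a₂ a₁ a₀ b₂ b₁ b₀ →
    (u₂ * n₂ + u₁ * n₁ + u₀ * n₀) * (a₀ * b₂ - a₂ * b₀)
    ≡ (u₂ * (a₁ * b₀ - a₀ * b₁) + u₁ * (a₀ * b₂ - a₂ * b₀) + u₀ * (a₂ * b₁ - a₁ * b₂)) * n₁
    + (n₂ * a₂ + n₁ * a₁ + n₀ * a₀) * (u₀ * b₂ - u₂ * b₀)
    + (- (n₂ * b₂ + n₁ * b₁ + n₀ * b₀)) * (u₀ * a₂ - u₂ * a₀)
  coord₁ = solve-∀
  coord₀ : ∀ u₂ u₁ u₀ n₂ n₁ n₀ a₂ a₁ a₀ b₂ b₁ b₀ →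
    (u₂ * n₂ + u₁ * n₁ + u₀ * n₀) * (a₂ * b₁ - a₁ * b₂)
    ≡ (u₂ * (a₁ * b₀ - a₀ * b₁) + u₁ * (a₀ * b₂ - a₂ * b₀) + u₀ * (a₂ * b₁ - a₁ * b₂)) * n₀
    + (n₂ * a₂ + n₁ * a₁ + n₀ * a₀) * (u₂ * b₁ - u₁ * b₂)
    + (- (n₂ * b₂ + n₁ * b₁ + n₀ * b₀)) * (u₂ * a₁ - u₁ * a₂)
  coord₀ = solve-∀

-- Cramer's rule for the linear dependence of four vectors of ℤ³.
four-vector-relation : ∀ u a b d →
  (u ∙ (a ⨯ b)) · d ≡ (((u ∙ (d ⨯ b)) · a) ⊕ ((u ∙ (a ⨯ d)) · b)) ⊕ (((a ⨯ b) ∙ d) · u)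
four-vector-relation (bqf u₂ u₁ u₀) (bqf a₂ a₁ a₀) (bqf b₂ b₁ b₀) (bqf d₂ d₁ d₀) = ≡-by-coords
  (coord₂ u₂ u₁ u₀ a₂ a₁ a₀ b₂ b₁ b₀ d₂ d₁ d₀)
  (coord₁ u₂ u₁ u₀ a₂ a₁ a₀ b₂ b₁ b₀ d₂ d₁ d₀)
  (coord₀ u₂ u₁ u₀ a₂ a₁ a₀ b₂ b₁ b₀ d₂ d₁ d₀)
  where
  coord₂ : ∀ u₂ u₁ u₀ a₂ a₁ a₀ b₂ b₁ b₀ d₂ d₁ d₀ →
    (u₂ * (a₁ * b₀ - a₀ * b₁) + u₁ * (a₀ * b₂ - a₂ * b₀) + u₀ * (a₂ * b₁ - a₁ * b₂)) * d₂
    ≡ (u₂ * (d₁ * b₀ - d₀ * b₁) + u₁ * (d₀ * b₂ - d₂ * b₀) + u₀ * (d₂ * b₁ - d₁ * b₂)) * a₂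
    + (u₂ * (a₁ * d₀ - a₀ * d₁) + u₁ * (a₀ * d₂ - a₂ * d₀) + u₀ * (a₂ * d₁ - a₁ * d₂)) * b₂
    + ((a₁ * b₀ - a₀ * b₁) * d₂ + (a₀ * b₂ - a₂ * b₀) * d₁ + (a₂ * b₁ - a₁ * b₂) * d₀) * u₂
  coord₂ = solve-∀
  coord₁ : ∀ u₂ u₁ u₀ a₂ a₁ a₀ b₂ b₁ b₀ d₂ d₁ d₀ →
    (u₂ * (a₁ * b₀ - a₀ * b₁) + u₁ * (a₀ * b₂ - a₂ * b₀) + u₀ * (a₂ * b₁ - a₁ * b₂)) * d₁
    ≡ (u₂ * (d₁ * b₀ - d₀ * b₁) + u₁ * (d₀ * b₂ - d₂ * b₀) + u₀ * (d₂ * b₁ - d₁ * b₂)) * a₁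
    + (u₂ * (a₁ * d₀ - a₀ * d₁) + u₁ * (a₀ * d₂ - a₂ * d₀) + u₀ * (a₂ * d₁ - a₁ * d₂)) * b₁
    + ((a₁ * b₀ - a₀ * b₁) * d₂ + (a₀ * b₂ - a₂ * b₀) * d₁ + (a₂ * b₁ - a₁ * b₂) * d₀) * u₁
  coord₁ = solve-∀
  coord₀ : ∀ u₂ u₁ u₀ a₂ a₁ a₀ b₂ b₁ b₀ d₂ d₁ d₀ →
    (u₂ * (a₁ * b₀ - a₀ * b₁) + u₁ * (a₀ * b₂ - a₂ * b₀) + u₀ * (a₂ * b₁ - a₁ * b₂)) * d₀
    ≡ (u₂ * (d₁ * b₀ - d₀ * b₁) + u₁ * (d₀ * b₂ - d₂ * b₀) + u₀ * (d₂ * b₁ - d₁ * b₂)) * a₀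
    + (u₂ * (a₁ * d₀ - a₀ * d₁) + u₁ * (a₀ * d₂ - a₂ * d₀) + u₀ * (a₂ * d₁ - a₁ * d₂)) * b₀
    + ((a₁ * b₀ - a₀ * b₁) * d₂ + (a₀ * b₂ - a₂ * b₀) * d₁ + (a₂ * b₁ - a₁ * b₂) * d₀) * u₀
  coord₀ = solve-∀


*≡0⇒≡0 : ∀ {k x} → k ≢ 0ℤ → k * x ≡ 0ℤ → x ≡ 0ℤ
*≡0⇒≡0 {k} k≢0 eq with ℤ.i*j≡0⇒i≡0∨j≡0 k eq
... | inj₁ k≡0 = ⊥-elim (k≢0 k≡0)
... | inj₂ x≡0 = x≡0

*-≢0 : ∀ {i j} → i ≢ 0ℤ → j ≢ 0ℤ → i * j ≢ 0ℤ
*-≢0 i≢0 j≢0 ij≡0 = j≢0 (*≡0⇒≡0 i≢0 ij≡0)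

·-zero-split : ∀ {k v} → k · v ≡ zeroForm → k ≡ 0ℤ ⊎ v ≡ zeroForm
·-zero-split {k} eq with k ℤ.≟ 0ℤ
... | yes k≡0 = inj₁ k≡0
... | no k≢0  = inj₂ (≡-by-coords (*≡0⇒≡0 k≢0 (cong c₂ eq))
                                  (*≡0⇒≡0 k≢0 (cong c₁ eq))
                                  (*≡0⇒≡0 k≢0 (cong c₀ eq)))

unit⇒≢0 : ∀ {t} → t ≡± 1ℤ → t ≢ 0ℤ
unit⇒≢0 (inj₁ refl) ()
unit⇒≢0 (inj₂ refl) ()

unit² : ∀ {t} → t ≡± 1ℤ → t * t ≡ 1ℤ
unit² (inj₁ refl) = refl
unit² (inj₂ refl) = refl

unit⇒*≡± : ∀ {t} → t ≡± 1ℤ → ∀ x → (t * x) ≡± x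
unit⇒*≡± (inj₁ refl) x = inj₁ (ℤ.*-identityˡ x)
unit⇒*≡± (inj₂ refl) x = inj₂ (ℤ.-1*i≡-i x)

*≡±⇒unit : ∀ {t x} → x ≢ 0ℤ → (t * x) ≡± x → t ≡± 1ℤ
*≡±⇒unit {t} {x} x≢0 (inj₁ tx≡x) =
  inj₁ (ℤ.*-cancelʳ-≡ t 1ℤ x {{ℤ.≢-nonZero x≢0}} (trans tx≡x (sym (ℤ.*-identityˡ x))))
*≡±⇒unit {t} {x} x≢0 (inj₂ tx≡-x) =
  inj₂ (ℤ.*-cancelʳ-≡ t -1ℤ x {{ℤ.≢-nonZero x≢0}} (trans tx≡-x (sym (ℤ.-1*i≡-i x))))

unit⇒∣1 : ∀ {t} → t ≡± 1ℤ → t ∣ 1ℤ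
unit⇒∣1 (inj₁ refl) = ∣-refl
unit⇒∣1 (inj₂ refl) = divides -1ℤ refl

∣1⇒unit : ∀ {d} → d ∣ 1ℤ → d ≡± 1ℤ
∣1⇒unit {d} d∣1 = ∣i∣≡1 d (∣1⇒≡1 (∣⇒∣ᵤ d∣1))
  where
  ∣i∣≡1 : ∀ i → ∣ i ∣ ≡ 1 → i ≡± 1ℤ
  ∣i∣≡1 (+ _)    refl = inj₁ refl
  ∣i∣≡1 -[1+ 0 ] refl = inj₂ refl

·-unit-involutive : ∀ {t} → t ≡± 1ℤ → ∀ x → t · (t · x) ≡ x
·-unit-involutive {t} t±1 x =
  trans (sym (·-assoc t t x)) (trans (cong (_· x) (unit² t±1)) (·-identityˡ x))

gcd³≡1⇔ : ∀ x y z →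
  gcd (gcd x y) z ≡ 1ℤ ⇔ (∀ d → d ∣ x → d ∣ y → d ∣ z → d ≡± 1ℤ)
gcd³≡1⇔ x y z = mk⇔ to from
  where
  G = gcd (gcd x y) z
  to : G ≡ 1ℤ → ∀ d → d ∣ x → d ∣ y → d ∣ z → d ≡± 1ℤ
  to G≡1 d d∣x d∣y d∣z = ∣1⇒unit (≡.subst (d ∣_) G≡1 (∣ᵤ⇒∣ d∣G))
    where
    d∣G = ℤ.gcd-greatest {gcd x y} {z} {d}
            (ℤ.gcd-greatest {x} {y} {d} (∣⇒∣ᵤ d∣x) (∣⇒∣ᵤ d∣y)) (∣⇒∣ᵤ d∣z)
  G∣gcd[x,y] : G ∣ gcd x y
  G∣gcd[x,y] = ∣ᵤ⇒∣ (ℤ.gcd[i,j]∣i (gcd x y) z)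
  from : (∀ d → d ∣ x → d ∣ y → d ∣ z → d ≡± 1ℤ) → G ≡ 1ℤ
  from units with units G (∣-trans G∣gcd[x,y] (∣ᵤ⇒∣ (ℤ.gcd[i,j]∣i x y)))
                          (∣-trans G∣gcd[x,y] (∣ᵤ⇒∣ (ℤ.gcd[i,j]∣j x y)))
                          (∣ᵤ⇒∣ (ℤ.gcd[i,j]∣j (gcd x y) z))
  ... | inj₁ G≡1 = G≡1
  ... | inj₂ ()

abs-as-multiple : ∀ i → ∃[ s ] + ∣ i ∣ ≡ s * i
abs-as-multiple (+ n)    = 1ℤ , sym (ℤ.*-identityˡ (+ n))
abs-as-multiple -[1+ n ] = -1ℤ , sym (ℤ.-1*i≡-i -[1+ n ])

Bézout-identity⇒ℤ : ∀ {d m n} → Bézout.Identity d m n →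
  ∃[ x ] ∃[ y ] x * + m + y * + n ≡ + d
Bézout-identity⇒ℤ {d} {m} {n} (Bézout.+- x y eq) =
  + x , - + y , rearrange (+ d) (+ y) (+ n) (trans (lift eq) (ℤ.pos-* x m))
  where
  lift : d ℕ.+ y ℕ.* n ≡ x ℕ.* m → + d + + y * + n ≡ + (x ℕ.* m)
  lift eq = trans (cong (_+_ (+ d)) (sym (ℤ.pos-* y n))) (trans (sym (ℤ.pos-+ d (y ℕ.* n))) (cong +_ eq))
  rearrange : ∀ d y n {p} → d + y * n ≡ p → p + (- y) * n ≡ d
  rearrange d y n refl = identity d y n
    where
    identity : ∀ d y n → d + y * n + (- y) * n ≡ d
    identity = solve-∀
Bézout-identity⇒ℤ {m = m} {n} (Bézout.-+ x y eq) with Bézout-identity⇒ℤ (Bézout.+- y x eq)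
... | p , q , pn+qm≡d = q , p , trans (ℤ.+-comm (q * + m) (p * + n)) pn+qm≡d

bézout : ∀ i j → ∃[ x ] ∃[ y ] x * i + y * j ≡ gcd i j
bézout i j with Bézout-identity⇒ℤ (Bézout.identity (gcd-GCD ∣ i ∣ ∣ j ∣))
              | abs-as-multiple i | abs-as-multiple j
... | x , y , eq | s , ∣i∣≡si | r , ∣j∣≡rj = x * s , y * r , (begin
  x * s * i + y * r * j         ≡⟨ reassociate x s i y r j ⟩
  x * (s * i) + y * (r * j)     ≡⟨ cong₂ (λ a b → x * a + y * b) ∣i∣≡si ∣j∣≡rj ⟨
  x * + ∣ i ∣ + y * + ∣ j ∣     ≡⟨ eq ⟩
  gcd i j                       ∎)
  where
  open ≡-Reasoning
  reassociate : ∀ x s i y r j → x * s * i + y * r * j ≡ x * (s * i) + y * (r * j)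
  reassociate = solve-∀

bézout³ : ∀ {α β γ} → gcd (gcd α β) γ ≡ 1ℤ →
  ∃[ x ] ∃[ y ] ∃[ z ] x * α + y * β + z * γ ≡ 1ℤ
bézout³ {α} {β} {γ} coprime = compose (bézout α β) (bézout (gcd α β) γ) coprime
  where
  -- A with-abstraction over terms mentioning gcd makes Agda normalise gcd and run out
  -- of memory; compose abstracts over the gcds instead.
  open ≡-Reasoning
  factor : ∀ p x y q α β γ → p * x * α + p * y * β + q * γ ≡ p * (x * α + y * β) + q * γ
  factor = solve-∀
  compose : ∀ {g h} → ∃[ x ] ∃[ y ] x * α + y * β ≡ g → ∃[ p ] ∃[ q ] p * g + q * γ ≡ h →
    h ≡ 1ℤ → ∃[ x ] ∃[ y ] ∃[ z ] x * α + y * β + z * γ ≡ 1ℤ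
  compose {g} {h} (x , y , xα+yβ≡g) (p , q , pg+qγ≡h) h≡1 = p * x , p * y , q , (begin
    p * x * α + p * y * β + q * γ   ≡⟨ factor p x y q α β γ ⟩
    p * (x * α + y * β) + q * γ     ≡⟨ cong (λ g → p * g + q * γ) xα+yβ≡g ⟩
    p * g + q * γ                   ≡⟨ pg+qγ≡h ⟩
    h                               ≡⟨ h≡1 ⟩
    1ℤ                              ∎)

nβ-even : ∀ {β} → 2 ∣ℕ ∣ β ∣ → nβ β ≡ 1ℤ
nβ-even {β} 2∣β = cong (λ b → if b then 1ℤ else + 2) (dec-true (2 ∣? ∣ β ∣) 2∣β)

nβ-odd : ∀ {β} → ¬ 2 ∣ℕ ∣ β ∣ → nβ β ≡ + 2
nβ-odd {β} 2∤β = cong (λ b → if b then 1ℤ else + 2) (dec-false (2 ∣? ∣ β ∣) 2∤β)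

nβ≢0 : ∀ β → nβ β ≢ 0ℤ
nβ≢0 β with does (2 ∣? ∣ β ∣)
... | true  = λ ()
... | false = λ ()

nβ-parity : ∀ β → (nβ β ≡ 1ℤ × ∃[ k ] β ≡ + 2 * k) ⊎ (nβ β ≡ + 2 × ∃[ k ] β ≡ + 2 * k + 1ℤ)
nβ-parity β with 2 ∣? ∣ β ∣
... | yes 2∣β with ∣ᵤ⇒∣ {+ 2} {β} 2∣β
...   | divides k β≡k*2 = inj₁ (nβ-even {β} 2∣β , k , trans β≡k*2 (ℤ.*-comm k (+ 2)))
nβ-parity β | no 2∤β with β ℤ.% + 2 | ℤ.n%d<d β (+ 2) | ℤ.a≡a%n+[a/n]*n β (+ 2)
... | 0 | _ | β≡[β/2]*2 =
  ⊥-elim (2∤β (∣⇒∣ᵤ (divides (β ℤ./ + 2) (trans β≡[β/2]*2 (ℤ.+-identityˡ _)))))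
... | 1 | _ | β≡1+[β/2]*2 = inj₂ (nβ-odd {β} 2∤β , β ℤ./ + 2 , trans β≡1+[β/2]*2 (reorder (β ℤ./ + 2)))
  where
  reorder : ∀ k → + 1 + k * + 2 ≡ + 2 * k + 1ℤ
  reorder = solve-∀
... | ℕ.suc (ℕ.suc _) | ℕ.s≤s (ℕ.s≤s ()) | _

-- The lattice n^⊥ = {c | n ∙ c = 0} of a primitive vector n, witnessed by u ∙ n = 1.
module UnimodularLattice {n u : BQF} (u∙n≡1 : u ∙ n ≡ 1ℤ) where
  open ≡-Reasoning

  u∙[k·n]≡k : ∀ k → u ∙ (k · n) ≡ k
  u∙[k·n]≡k k = trans (∙-·ʳ k u n) (trans (cong (k *_) u∙n≡1) (ℤ.*-identityʳ k))

  ·n-injective : ∀ {k l} → k · n ≡ l · n → k ≡ l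
  ·n-injective {k} {l} eq = trans (sym (u∙[k·n]≡k k)) (trans (cong (u ∙_) eq) (u∙[k·n]≡k l))

  -- For a, b ⊥ n this is ± the index of the lattice ℤa + ℤb in n^⊥.
  index : BQF → BQF → ℤ
  index a b = u ∙ (a ⨯ b)

  module _ {a b : BQF} (n∙a≡0 : n ∙ a ≡ 0ℤ) (n∙b≡0 : n ∙ b ≡ 0ℤ) where

    ⨯-parallel : a ⨯ b ≡ index a b · n
    ⨯-parallel = begin
      a ⨯ b                     ≡⟨ ·-identityˡ (a ⨯ b) ⟨
      1ℤ · (a ⨯ b)              ≡⟨ cong (_· (a ⨯ b)) u∙n≡1 ⟨
      (u ∙ n) · (a ⨯ b)          ≡⟨ ⨯-decomposition u n a b ⟩
      ((index a b · n) ⊕ ((n ∙ a) · (u ⨯ b))) ⊕ ((- (n ∙ b)) · (u ⨯ a))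
        ≡⟨ cong₂ (λ k l → ((index a b · n) ⊕ (k · (u ⨯ b))) ⊕ ((- l) · (u ⨯ a))) n∙a≡0 n∙b≡0 ⟩
      ((index a b · n) ⊕ (0ℤ · (u ⨯ b))) ⊕ (0ℤ · (u ⨯ a))
        ≡⟨ trans (⊕-0· _ (u ⨯ a)) (⊕-0· _ (u ⨯ b)) ⟩
      index a b · n             ∎

    common-divisors-units⇔unit : (∀ d → d ∣ᵛ (a ⨯ b) → d ≡± 1ℤ) ⇔ index a b ≡± 1ℤ
    common-divisors-units⇔unit = mk⇔ to from
      where
      to : (∀ d → d ∣ᵛ (a ⨯ b) → d ≡± 1ℤ) → index a b ≡± 1ℤ
      to units = units (index a b) (≡.subst (index a b ∣ᵛ_) (sym ⨯-parallel) (∣ᵛ-· _ n))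
      from : index a b ≡± 1ℤ → ∀ d → d ∣ᵛ (a ⨯ b) → d ≡± 1ℤ
      from t±1 d d∣a⨯b = ∣1⇒unit (∣-trans d∣t (unit⇒∣1 t±1))
        where
        d∣t : d ∣ index a b
        d∣t = ≡.subst (d ∣_) (u∙[k·n]≡k _) (∣ᵛ⇒∣∙ u (≡.subst (d ∣ᵛ_) ⨯-parallel d∣a⨯b))

    unit⇒spans : index a b ≡± 1ℤ → ∀ c → n ∙ c ≡ 0ℤ → InSpan a b c
    unit⇒spans t±1 c n∙c≡0 = t * index c b , t * index a c , (begin
      c                                         ≡⟨ ·-unit-involutive t±1 c ⟨
      t · (t · c)                               ≡⟨ cong (t ·_) t·c≡ ⟩
      t · ((index c b · a) ⊕ (index a c · b))   ≡⟨ ·-distrib-span t _ _ a b ⟩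
      ((t * index c b) · a) ⊕ ((t * index a c) · b) ∎)
      where
      t = index a b
      [a,b,c]≡0 : (a ⨯ b) ∙ c ≡ 0ℤ
      [a,b,c]≡0 = begin
        (a ⨯ b) ∙ c      ≡⟨ cong (_∙ c) ⨯-parallel ⟩
        (t · n) ∙ c      ≡⟨ ∙-·ˡ t n c ⟩
        t * (n ∙ c)      ≡⟨ cong (t *_) n∙c≡0 ⟩
        t * 0ℤ           ≡⟨ ℤ.*-zeroʳ t ⟩
        0ℤ               ∎
      span-part = (index c b · a) ⊕ (index a c · b)
      t·c≡ : t · c ≡ span-part
      t·c≡ = trans (four-vector-relation u a b c)
                   (trans (cong (λ k → span-part ⊕ (k · u)) [a,b,c]≡0) (⊕-0· span-part u))

    -- n ⨯ x lies in n^⊥, and the cross product of two such vectors is (n ∙ (x ⨯ y)) · n;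
    -- so t divides every n ∙ (x ⨯ y), hence every coordinate of n, hence u ∙ n = 1.
    spans⇒unit : (∀ c → n ∙ c ≡ 0ℤ → InSpan a b c) → index a b ≡± 1ℤ
    spans⇒unit spans = ∣1⇒unit (≡.subst (t ∣_) u∙n≡1 (∣ᵛ⇒∣∙ u t∣ᵛn))
      where
      t = index a b
      t∣n∙⨯ : ∀ x y → t ∣ n ∙ (x ⨯ y)
      t∣n∙⨯ x y with spans (n ⨯ x) (∙-⨯-self n x) | spans (n ⨯ y) (∙-⨯-self n y)
      ... | p , q , n⨯x≡ | r , s , n⨯y≡ = divides (p * s - r * q) (·n-injective (begin
        (n ∙ (x ⨯ y)) · n                         ≡⟨ ⨯-⨯-common n x y ⟨
        (n ⨯ x) ⨯ (n ⨯ y)                         ≡⟨ cong₂ _⨯_ n⨯x≡ n⨯y≡ ⟩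
        ((p · a) ⊕ (q · b)) ⨯ ((r · a) ⊕ (s · b)) ≡⟨ ⨯-bilinear a b p q r s ⟩
        (p * s - r * q) · (a ⨯ b)                 ≡⟨ cong ((p * s - r * q) ·_) ⨯-parallel ⟩
        (p * s - r * q) · (t · n)                 ≡⟨ ·-assoc (p * s - r * q) t n ⟨
        ((p * s - r * q) * t) · n                 ∎))
      t∣ᵛn : t ∣ᵛ n
      t∣ᵛn with ∙-basis n
      ... | n∙e₂≡n₂ , n∙e₁≡n₁ , n∙e₀≡n₀ = ≡.subst (t ∣_) n∙e₂≡n₂ (t∣n∙⨯ e₁ e₀)
                                        , ≡.subst (t ∣_) n∙e₁≡n₁ (t∣n∙⨯ e₀ e₂)
                                        , ≡.subst (t ∣_) n∙e₀≡n₀ (t∣n∙⨯ e₂ e₁)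

-- W_J(ℤ) is the orthogonal complement of this vector (see twist-decomposition).
W-normal : BQF → BQF
W-normal J = bqf (+ 2 * c₀ J) (- c₁ J) (+ 2 * c₂ J)

-- (n_β / 2) · W-normal J, the primitive normal of W_J; m stands for n_β β / 2.
primitiveNormal : BQF → ℤ → BQF
primitiveNormal J m = bqf (nβ (c₁ J) * c₀ J) (- m) (nβ (c₁ J) * c₂ J)

-- J_(f,g) = dualForm (f ⨯ g), and dualForm maps the primitive normal of W_J to n_β J.
dualForm : BQF → BQF
dualForm X = bqf (c₀ X) (- (+ 2 * c₁ X)) (c₂ X)

twist-decomposition : ∀ J φ →
  subst φ (M J) ≡ (((- + 1) * det (M J)) · φ) ⊕ ((W-normal J ∙ φ) · ((+ 2) · J))
twist-decomposition (bqf α β γ) (bqf φ₂ φ₁ φ₀) = ≡-by-coords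
  (coord₂ α β γ φ₂ φ₁ φ₀) (coord₁ α β γ φ₂ φ₁ φ₀) (coord₀ α β γ φ₂ φ₁ φ₀)
  where
  coord₂ : ∀ α β γ φ₂ φ₁ φ₀ →
    φ₂ * β * β + φ₁ * β * (- (+ 2 * α)) + φ₀ * (- (+ 2 * α)) * (- (+ 2 * α))
    ≡ (- (+ 1)) * (β * (- β) - + 2 * γ * (- (+ 2 * α))) * φ₂
    + (+ 2 * γ * φ₂ + (- β) * φ₁ + + 2 * α * φ₀) * (+ 2 * α)
  coord₂ = solve-∀
  coord₁ : ∀ α β γ φ₂ φ₁ φ₀ →
    + 2 * φ₂ * β * (+ 2 * γ) + φ₁ * (β * (- β) + + 2 * γ * (- (+ 2 * α))) + + 2 * φ₀ * (- (+ 2 * α)) * (- β)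
    ≡ (- (+ 1)) * (β * (- β) - + 2 * γ * (- (+ 2 * α))) * φ₁
    + (+ 2 * γ * φ₂ + (- β) * φ₁ + + 2 * α * φ₀) * (+ 2 * β)
  coord₁ = solve-∀
  coord₀ : ∀ α β γ φ₂ φ₁ φ₀ →
    φ₂ * (+ 2 * γ) * (+ 2 * γ) + φ₁ * (+ 2 * γ) * (- β) + φ₀ * (- β) * (- β)
    ≡ (- (+ 1)) * (β * (- β) - + 2 * γ * (- (+ 2 * α))) * φ₀
    + (+ 2 * γ * φ₂ + (- β) * φ₁ + + 2 * α * φ₀) * (+ 2 * γ)
  coord₀ = solve-∀

InW⇔W-normal⊥ : ∀ {J} → J ≢ zeroForm → ∀ φ → InW J φ ⇔ W-normal J ∙ φ ≡ 0ℤ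
InW⇔W-normal⊥ {J} J≢0 φ = mk⇔ to from
  where
  to : InW J φ → W-normal J ∙ φ ≡ 0ℤ
  to φ∈W with ·-zero-split (⊕-cancel (trans (sym φ∈W) (twist-decomposition J φ)))
  ... | inj₁ w∙φ≡0 = w∙φ≡0
  ... | inj₂ 2J≡0 with ·-zero-split {+ 2} {J} 2J≡0
  ...   | inj₁ ()
  ...   | inj₂ J≡0 = ⊥-elim (J≢0 J≡0)
  from : W-normal J ∙ φ ≡ 0ℤ → InW J φ
  from w∙φ≡0 = trans (twist-decomposition J φ)
                     (trans (cong (λ k → scaledφ ⊕ (k · ((+ 2) · J))) w∙φ≡0) (⊕-0· scaledφ ((+ 2) · J)))
    where scaledφ = ((- + 1) * det (M J)) · φ

⊥-rescale : ∀ k l w n → k ≢ 0ℤ → l ≢ 0ℤ → k · w ≡ l · n →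
  ∀ φ → w ∙ φ ≡ 0ℤ ⇔ n ∙ φ ≡ 0ℤ
⊥-rescale k l w n k≢0 l≢0 kw≡ln φ = mk⇔
  (λ w∙φ≡0 → *≡0⇒≡0 l≢0 (trans (sym scaled) (trans (cong (k *_) w∙φ≡0) (ℤ.*-zeroʳ k))))
  (λ n∙φ≡0 → *≡0⇒≡0 k≢0 (trans scaled (trans (cong (l *_) n∙φ≡0) (ℤ.*-zeroʳ l))))
  where
  scaled : k * (w ∙ φ) ≡ l * (n ∙ φ)
  scaled = trans (sym (∙-·ˡ k w φ)) (trans (cong (_∙ φ) kw≡ln) (∙-·ˡ l n φ))

W-normal-rescale : ∀ α β γ m → + 2 * m ≡ nβ β * β →
  nβ β · W-normal (bqf α β γ) ≡ (+ 2) · primitiveNormal (bqf α β γ) m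
W-normal-rescale α β γ m 2m≡eβ = ≡-by-coords
  (swap (nβ β) γ)
  (begin
    nβ β * (- β)   ≡⟨ ℤ.neg-distribʳ-* (nβ β) β ⟨
    - (nβ β * β)   ≡⟨ cong -_ 2m≡eβ ⟨
    - (+ 2 * m)    ≡⟨ ℤ.neg-distribʳ-* (+ 2) m ⟩
    + 2 * (- m)    ∎)
  (swap (nβ β) α)
  where
  open ≡-Reasoning
  swap : ∀ e x → e * (+ 2 * x) ≡ + 2 * (e * x)
  swap = solve-∀

primitiveNormal-unimodular : ∀ α β γ → ∃[ x ] ∃[ y ] ∃[ z ] x * α + y * β + z * γ ≡ 1ℤ →
  ∃[ m ] + 2 * m ≡ nβ β * β × ∃[ u ] u ∙ primitiveNormal (bqf α β γ) m ≡ 1ℤ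
primitiveNormal-unimodular α β γ (x , y , z , bézout-eq) with nβ-parity β
... | inj₁ (nβ≡1 , k , refl) rewrite nβ≡1 =
  k , sym (ℤ.*-identityˡ (+ 2 * k)) , bqf z (- (+ 2 * y)) x , (begin
    z * (1ℤ * γ) + - (+ 2 * y) * - k + x * (1ℤ * α) ≡⟨ even-case x y z k α γ ⟩
    x * α + y * (+ 2 * k) + z * γ                    ≡⟨ bézout-eq ⟩
    1ℤ                                               ∎)
  where
  open ≡-Reasoning
  even-case : ∀ x y z k α γ →
    z * (1ℤ * γ) + - (+ 2 * y) * - k + x * (1ℤ * α) ≡ x * α + y * (+ 2 * k) + z * γ
  even-case = solve-∀
... | inj₂ (nβ≡2 , k , refl) rewrite nβ≡2 =
  + 2 * k + 1ℤ , refl , bqf (- (k * z)) (+ 2 * k * y - 1ℤ) (- (k * x)) , (begin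
    - (k * z) * (+ 2 * γ) + (+ 2 * k * y - 1ℤ) * - b + - (k * x) * (+ 2 * α)
      ≡⟨ odd-case x y z k α γ ⟩
    b - + 2 * k * (x * α + y * b + z * γ)   ≡⟨ cong (λ s → b - + 2 * k * s) bézout-eq ⟩
    b - + 2 * k * 1ℤ                        ≡⟨ odd-final k ⟩
    1ℤ                                      ∎)
  where
  open ≡-Reasoning
  b = + 2 * k + 1ℤ
  odd-case : ∀ x y z k α γ →
    - (k * z) * (+ 2 * γ) + (+ 2 * k * y - 1ℤ) * - (+ 2 * k + 1ℤ) + - (k * x) * (+ 2 * α)
    ≡ + 2 * k + 1ℤ - + 2 * k * (x * α + y * (+ 2 * k + 1ℤ) + z * γ)
  odd-case = solve-∀
  odd-final : ∀ k → + 2 * k + 1ℤ - + 2 * k * 1ℤ ≡ 1ℤ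
  odd-final = solve-∀

disc≢0⇒≢zeroForm : ∀ {J} → disc J ≢ 0ℤ → J ≢ zeroForm
disc≢0⇒≢zeroForm disc≢0 refl = disc≢0 refl

disc-· : ∀ k φ → disc (k · φ) ≡ (k * k) * disc φ
disc-· k (bqf φ₂ φ₁ φ₀) = identity k φ₂ φ₁ φ₀
  where
  identity : ∀ k φ₂ φ₁ φ₀ →
    k * φ₁ * (k * φ₁) - + 4 * (k * φ₂) * (k * φ₀) ≡ k * k * (φ₁ * φ₁ - + 4 * φ₂ * φ₀)
  identity = solve-∀

Jfg₁/2≡-c₁⨯ : ∀ f g → Jfg₁/2 f g ≡ - c₁ (f ⨯ g)
Jfg₁/2≡-c₁⨯ f g = identity (c₂ f) (c₀ f) (c₂ g) (c₀ g)
  where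
  identity : ∀ f₂ f₀ g₂ g₀ → f₂ * g₀ - f₀ * g₂ ≡ - (f₀ * g₂ - f₂ * g₀)
  identity = solve-∀

Jfg≡dualForm-⨯ : ∀ f g → Jfg f g ≡ dualForm (f ⨯ g)
Jfg≡dualForm-⨯ f g = ≡-by-coords refl
  (trans (cong (_*_ (+ 2)) (Jfg₁/2≡-c₁⨯ f g)) (sym (ℤ.neg-distribʳ-* (+ 2) (c₁ (f ⨯ g)))))
  refl

dualForm-· : ∀ k X → dualForm (k · X) ≡ k · dualForm X
dualForm-· k X = ≡-by-coords refl (identity k (c₁ X)) refl
  where
  identity : ∀ k x → - (+ 2 * (k * x)) ≡ k * - (+ 2 * x)
  identity = solve-∀

dualForm-primitiveNormal : ∀ α β γ m → + 2 * m ≡ nβ β * β →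
  dualForm (primitiveNormal (bqf α β γ) m) ≡ nβ β · bqf α β γ
dualForm-primitiveNormal α β γ m 2m≡eβ = ≡-by-coords refl
  (trans (cong -_ (sym (ℤ.neg-distribʳ-* (+ 2) m))) (trans (ℤ.neg-involutive _) 2m≡eβ))
  refl

Jfg-coprime⇔ : ∀ f g →
  gcd (gcd (c₂ (Jfg f g)) (Jfg₁/2 f g)) (c₀ (Jfg f g)) ≡ 1ℤ
    ⇔ (∀ d → d ∣ᵛ (f ⨯ g) → d ≡± 1ℤ)
Jfg-coprime⇔ f g = ⇔-trans (gcd³≡1⇔ _ _ _) (mk⇔ to from)
  where
  X = f ⨯ g
  to : (∀ d → d ∣ c₀ X → d ∣ Jfg₁/2 f g → d ∣ c₂ X → d ≡± 1ℤ) →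
       ∀ d → d ∣ᵛ X → d ≡± 1ℤ
  to units d (d∣X₂ , d∣X₁ , d∣X₀) =
    units d d∣X₀ (≡.subst (d ∣_) (sym (Jfg₁/2≡-c₁⨯ f g)) (∣m⇒∣-m d∣X₁)) d∣X₂
  from : (∀ d → d ∣ᵛ X → d ≡± 1ℤ) →
         ∀ d → d ∣ c₀ X → d ∣ Jfg₁/2 f g → d ∣ c₂ X → d ≡± 1ℤ
  from units d d∣X₀ d∣half d∣X₂ = units d (d∣X₂ , d∣X₁ , d∣X₀)
    where
    d∣X₁ = ≡.subst (d ∣_) (ℤ.neg-involutive _) (∣m⇒∣-m (≡.subst (d ∣_) (Jfg₁/2≡-c₁⨯ f g) d∣half))

¬Proportional⇒independent : ∀ {f g} → ¬ Proportional f g →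
  ∀ a b → ((a · f) ⊕ (b · g)) ≡ zeroForm → a ≡ 0ℤ × b ≡ 0ℤ
¬Proportional⇒independent f≁g a b eq with a ℤ.≟ 0ℤ | b ℤ.≟ 0ℤ
... | yes a≡0 | yes b≡0 = a≡0 , b≡0
... | no a≢0  | _       = ⊥-elim (f≁g (a , b , (λ (a≡0 , _) → a≢0 a≡0) , eq))
... | yes _   | no b≢0  = ⊥-elim (f≁g (a , b , (λ (_ , b≡0) → b≢0 b≡0) , eq))

module Classification
  (α β γ : ℤ) (disc≢0 : disc (bqf α β γ) ≢ 0ℤ)
  (normal : ∃[ m ] + 2 * m ≡ nβ β * β × ∃[ u ] u ∙ primitiveNormal (bqf α β γ) m ≡ 1ℤ)
  (f g : BQF) (f∈W : InW (bqf α β γ) f) (g∈W : InW (bqf α β γ) g)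
  where

  m : ℤ
  m = proj₁ normal

  2m≡eβ : + 2 * m ≡ nβ β * β
  2m≡eβ = proj₁ (proj₂ normal)

  J n u : BQF
  J = bqf α β γ
  n = primitiveNormal J m
  u = proj₁ (proj₂ (proj₂ normal))

  open UnimodularLattice {n} {u} (proj₂ (proj₂ (proj₂ normal)))
  open ≡-Reasoning

  e t : ℤ
  e = nβ β
  t = index f g

  InW⇔n⊥ : ∀ φ → InW J φ ⇔ n ∙ φ ≡ 0ℤ
  InW⇔n⊥ φ = ⇔-trans (InW⇔W-normal⊥ (disc≢0⇒≢zeroForm disc≢0) φ)
    (⊥-rescale e (+ 2) (W-normal J) n (nβ≢0 β) (λ ()) (W-normal-rescale α β γ m 2m≡eβ) φ)

  n∙f≡0 : n ∙ f ≡ 0ℤ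
  n∙f≡0 = Equivalence.to (InW⇔n⊥ f) f∈W

  n∙g≡0 : n ∙ g ≡ 0ℤ
  n∙g≡0 = Equivalence.to (InW⇔n⊥ g) g∈W

  Jfg≡ : Jfg f g ≡ (t * e) · J
  Jfg≡ = begin
    Jfg f g            ≡⟨ Jfg≡dualForm-⨯ f g ⟩
    dualForm (f ⨯ g)   ≡⟨ cong dualForm (⨯-parallel n∙f≡0 n∙g≡0) ⟩
    dualForm (t · n)   ≡⟨ dualForm-· t n ⟩
    t · dualForm n     ≡⟨ cong (t ·_) (dualForm-primitiveNormal α β γ m 2m≡eβ) ⟩
    t · (e · J)        ≡⟨ ·-assoc t e J ⟨
    (t * e) · J        ∎

  primitive⇔unit : Primitive f g ⇔ t ≡± 1ℤ
  primitive⇔unit = mk⇔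
    (λ (_ , coprime) → Equivalence.to divisors⇔unit (Equivalence.to (Jfg-coprime⇔ f g) coprime))
    (λ t±1 → disc[Jfg]≢0 t±1
           , Equivalence.from (Jfg-coprime⇔ f g) (Equivalence.from divisors⇔unit t±1))
    where
    divisors⇔unit = common-divisors-units⇔unit n∙f≡0 n∙g≡0
    disc[Jfg]≢0 : t ≡± 1ℤ → disc (Jfg f g) ≢ 0ℤ
    disc[Jfg]≢0 t±1 = ≡.subst (_≢ 0ℤ) (sym disc[Jfg]≡) (*-≢0 (*-≢0 te≢0 te≢0) disc≢0)
      where
      te≢0 = *-≢0 (unit⇒≢0 t±1) (nβ≢0 β)
      disc[Jfg]≡ : disc (Jfg f g) ≡ (t * e) * (t * e) * disc J
      disc[Jfg]≡ = trans (cong disc Jfg≡) (disc-· (t * e) J)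

  basis⇔unit : ¬ Proportional f g → IsZBasisW J f g ⇔ t ≡± 1ℤ
  basis⇔unit f≁g = mk⇔
    (λ (_ , _ , spans , _) → spans⇒unit n∙f≡0 n∙g≡0
       (λ c n∙c≡0 → spans c (Equivalence.from (InW⇔n⊥ c) n∙c≡0)))
    (λ t±1 → f∈W , g∈W
       , (λ φ φ∈W → unit⇒spans n∙f≡0 n∙g≡0 t±1 φ (Equivalence.to (InW⇔n⊥ φ) φ∈W))
       , ¬Proportional⇒independent f≁g)

  c₂-Jfg : c₂ (Jfg f g) ≡ t * (e * α)
  c₂-Jfg = trans (cong c₂ Jfg≡) (ℤ.*-assoc t e α)

  c₁-Jfg : c₁ (Jfg f g) ≡ t * (e * β)
  c₁-Jfg = trans (cong c₁ Jfg≡) (ℤ.*-assoc t e β)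

  iii⇔unit : (c₂ (Jfg f g) ≡± (e * α) × c₁ (Jfg f g) ≡± (e * β)) ⇔ t ≡± 1ℤ
  iii⇔unit = mk⇔ to
    (λ t±1 → ≡.subst (_≡± (e * α)) (sym c₂-Jfg) (unit⇒*≡± t±1 (e * α))
           , ≡.subst (_≡± (e * β)) (sym c₁-Jfg) (unit⇒*≡± t±1 (e * β)))
    where
    to : c₂ (Jfg f g) ≡± (e * α) × c₁ (Jfg f g) ≡± (e * β) → t ≡± 1ℤ
    to (h₂ , h₁) = by-cases (α ℤ.≟ 0ℤ)
      where
      by-cases : Dec (α ≡ 0ℤ) → t ≡± 1ℤ
      by-cases (no α≢0)  = *≡±⇒unit (*-≢0 (nβ≢0 β) α≢0) (≡.subst (_≡± (e * α)) c₂-Jfg h₂)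
      by-cases (yes α≡0) = *≡±⇒unit (*-≢0 (nβ≢0 β) β≢0) (≡.subst (_≡± (e * β)) c₁-Jfg h₁)
        where
        β≢0 : β ≢ 0ℤ
        β≢0 β≡0 = disc≢0 (cong₂ (λ a b → disc (bqf a b γ)) α≡0 β≡0)

  unit⇒iv : t ≡± 1ℤ → Jfg f g ≡ e · J ⊎ Jfg f g ≡ (- e) · J
  unit⇒iv t±1 = Sum.map scaled scaled (unit⇒*≡± t±1 e)
    where
    scaled : ∀ {k} → t * e ≡ k → Jfg f g ≡ k · J
    scaled te≡k = trans Jfg≡ (cong (_· J) te≡k)

  iv⇒iii : Jfg f g ≡ e · J ⊎ Jfg f g ≡ (- e) · J →
           c₂ (Jfg f g) ≡± (e * α) × c₁ (Jfg f g) ≡± (e * β)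
  iv⇒iii (inj₁ Jfg≡eJ)  = inj₁ (cong c₂ Jfg≡eJ) , inj₁ (cong c₁ Jfg≡eJ)
  iv⇒iii (inj₂ Jfg≡-eJ) = inj₂ (trans (cong c₂ Jfg≡-eJ) (sym (ℤ.neg-distribˡ-* e α)))
                        , inj₂ (trans (cong c₁ Jfg≡-eJ) (sym (ℤ.neg-distribˡ-* e β)))

proposition3p5 : (α β γ : ℤ)
    → gcd (gcd α β) γ ≡ + 1
    → ¬ (disc (bqf α β γ) ≡ + 0)
    → (f g : BQF)
    → InW (bqf α β γ) f → InW (bqf α β γ) g
    → ¬ Proportional f g
    → (Primitive f g ⇔ IsZBasisW (bqf α β γ) f g)
      × (IsZBasisW (bqf α β γ) f g
          ⇔ (c₂ (Jfg f g) ≡± (nβ β * α) × c₁ (Jfg f g) ≡± (nβ β * β)))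
      × ((c₂ (Jfg f g) ≡± (nβ β * α) × c₁ (Jfg f g) ≡± (nβ β * β))
          ⇔ (Jfg f g ≡ nβ β · bqf α β γ ⊎ Jfg f g ≡ (- nβ β) · bqf α β γ))
proposition3p5 α β γ coprime disc≢0 f g f∈W g∈W f≁g =
    ⇔-trans primitive⇔unit (⇔-sym (basis⇔unit f≁g))
  , ⇔-trans (basis⇔unit f≁g) (⇔-sym iii⇔unit)
  , mk⇔ (unit⇒iv ∘ Equivalence.to iii⇔unit) iv⇒iii
  where
  open Classification α β γ disc≢0 (primitiveNormal-unimodular α β γ (bézout³ coprime)) f g f∈W g∈W
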